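{- Let $H=(\mathcal{X},\xi)$ be a hypergraph with transversal number $k=\tau(H)$, and let $T=\{x_1,\dots,x_k\}$ be a minimal transversal of $H$ of cardinality $k$, its vertices indexed in decreasing order of support (the number of hyperedges containing the vertex). For $i=1,\dots,k$ define the partial hypergraph $H_i=(\mathcal{X}_i,\xi_i)$ by $\xi_i=\{e\in\xi\setminus\bigcup_{j=1}^{i-1}\xi_j : x_i\in e\}$ and $\mathcal{X}_i=\bigcup_{e\in\xi_i}e$. Let $\mathcal{M}_{H_i}$ denote the set of minimal transversals of $H_i$ and $\mathcal{M}_H$ that of $H$. Then every minimal transversal of $H$ can be obtained from the sets $\mathcal{M}_{H_1},\dots,\mathcal{M}_{H_k}$; namely $$\mathcal{M}_H=\mathrm{Min}\{T_1\cup T_2\cup\dots\cup T_k : T_i\in\mathcal{M}_{H_i},\ i=1,\dots,k\},$$ where $\mathrm{Min}(\mathcal{F})$ denotes the set of inclusion-minimal members of a family $\mathcal{F}$ of sets.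
   Context: A hypergraph $H=(\mathcal{X},\xi)$ consists of a finite set $\mathcal{X}$ and a family $\xi$ of nonempty subsets (hyperedges) of $\mathcal{X}$ whose union is $\mathcal{X}$. A transversal of $H$ is a set of vertices meeting every hyperedge; it is minimal if no other transversal is strictly contained in it. The transversal number $\tau(H)$ is the minimum cardinality of a minimal transversal of $H$. -}

module Defs where

open import Data.Nat using (ℕ; _≤_)
open import Data.Fin as Fin using (Fin)
open import Data.Fin.Subset using (Subset; _∈_; _∉_; _⊆_; _⊂_; _∩_; Nonempty; ⋃; ∣_∣)
open import Data.Fin.Subset.Properties using (_∈?_)
open import Data.List using (List; filter; length)
open import Data.List.Relation.Unary.All using (All)
import Data.List.Membership.Propositional as LM
open import Data.Vec using (Vec; []; _∷_; lookup)
open import Data.Product using (Σ; ∃; _×_)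
open import Relation.Nullary using (¬_; ¬?)
open import Relation.Binary.PropositionalEquality using (_≡_)
open import Function.Bundles using (_⇔_)
open import Function.Definitions using (Injective)

-- A hypergraph on the vertex set Fin n: a family (list, repetitions allowed)
-- of nonempty hyperedges whose union is the whole vertex set.
record Hypergraph (n : ℕ) : Set where
  field
    edges    : List (Subset n)
    nonempty : All Nonempty edges
    covers   : ∀ (v : Fin n) → Σ (Subset n) (λ e → e LM.∈ edges × v ∈ e)

open Hypergraph public

module _ {n : ℕ} where

  -- The hypergraph with edge family es has vertex set ⋃ es.
  -- S is a transversal of the edge family es: S ⊆ ⋃ es and S meets every edge.
  IsTransversal : List (Subset n) → Subset n → Set
  IsTransversal es S = S ⊆ ⋃ es × All (λ e → Nonempty (S ∩ e)) es

  IsMinTransversal : List (Subset n) → Subset n → Set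
  IsMinTransversal es S =
    IsTransversal es S × (∀ S′ → S′ ⊂ S → ¬ IsTransversal es S′)

  IsTransversalNumber : List (Subset n) → ℕ → Set
  IsTransversalNumber es k =
    (Σ (Subset n) λ S → IsMinTransversal es S × ∣ S ∣ ≡ k)
    × (∀ S → IsMinTransversal es S → k ≤ ∣ S ∣)

  support : List (Subset n) → Fin n → ℕ
  support es x = length (filter (x ∈?_) es)

  -- The partial hypergraphs' edge families ξ₁,…,ξₖ:
  -- ξᵢ = { e ∈ ξ ∖ (ξ₁ ∪ … ∪ ξᵢ₋₁) : xᵢ ∈ e }.
  -- The second argument is the family of edges not yet used by ξ₁,…,ξᵢ₋₁.
  partials : ∀ {k} → Vec (Fin n) k → List (Subset n) → Vec (List (Subset n)) k
  partials []       es = []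
  partials (x ∷ xs) es =
    filter (x ∈?_) es ∷ partials xs (filter (λ e → ¬? (x ∈? e)) es)

  InUnionFamily : ∀ {k} → Vec (List (Subset n)) k → Subset n → Set
  InUnionFamily {k} ξs S =
    Σ (Vec (Subset n) k) λ Ts →
      (∀ i → IsMinTransversal (lookup ξs i) (lookup Ts i))
      × S ≡ ⋃ (Data.Vec.toList Ts)

  IsMinMember : (Subset n → Set) → Subset n → Set
  IsMinMember F S = F S × (∀ S′ → F S′ → ¬ (S′ ⊂ S))

-- Since T meets every edge and each vertex of T is some xᵢ, the families ξ₁,…,ξₖ cover ξ. Hence
-- any union T₁ ∪ … ∪ Tₖ of transversals of the Hᵢ is a transversal of H. Conversely a minimal
-- transversal S of H restricts to a transversal S ∩ 𝒳ᵢ of each Hᵢ, which contains a minimal one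
-- Tᵢ; the union of the Tᵢ is a transversal of H inside S, so it is S.
module Submission where

open import Defs
open import Data.Nat using (ℕ; _≤_; _<_)
open import Data.Nat.Induction using (<-wellFounded)
open import Data.Fin as Fin using (Fin)
open import Data.Fin.Properties using (any?)
open import Data.Fin.Subset
  using (Subset; _∈_; ∣_∣; _⊆_; _∩_; _-_; ⋃; Nonempty)
open import Data.Fin.Subset.Properties
  using (_∈?_; _⊆?_; nonempty?; ⊆-trans; ⊆-antisym; ⊆-⊂-trans; ∉⊥; x∈p∩q⁺; x∈p∩q⁻; x∈p∪q⁻;
         p⊆p∪q; q⊆p∪q; p─q⊆p; x∈p∧x≢y⇒x∈p-y; x∈p⇒∣p-x∣<∣p∣)
open import Data.Vec using (Vec; []; _∷_; lookup; toList; tabulate)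
open import Data.Vec.Properties using (lookup∘tabulate)
open import Data.Vec.Membership.Propositional.Properties using (∈-lookup; ∈-toList⁺; ∈-toList⁻)
open import Data.Vec.Relation.Unary.Any using (index)
open import Data.Vec.Relation.Unary.Any.Properties using (lookup-index)
open import Data.List using (List; []; _∷_)
open import Data.List.Relation.Unary.Any using (here; there)
import Data.List.Relation.Unary.All as All
open import Data.List.Membership.Propositional using () renaming (_∈_ to _∈L_)
open import Data.List.Membership.Propositional.Properties using (∈-filter⁺; ∈-filter⁻)
open import Data.Product using (Σ; ∃; _×_; _,_; proj₁; proj₂)
open import Data.Sum using (inj₁; inj₂)
open import Data.Empty using (⊥-elim)
open import Function using (_∘_)
open import Induction.WellFounded using (Acc; acc)
open import Relation.Nullary using (¬_; ¬?; Dec; yes; no)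
open import Relation.Nullary.Decidable using (_×-dec_)
open import Relation.Binary.PropositionalEquality using (_≡_; refl; sym; subst)
open import Function.Bundles using (_⇔_; mk⇔; Equivalence)
open import Function.Definitions using (Injective)

module _ {n : ℕ} where

  ⋃-upper : ∀ {p : Subset n} {ps} → p ∈L ps → p ⊆ ⋃ ps
  ⋃-upper {ps = q ∷ ps} (here refl) = p⊆p∪q (⋃ ps)
  ⋃-upper {ps = q ∷ ps} (there p∈ps) = q⊆p∪q q (⋃ ps) ∘ ⋃-upper p∈ps

  ⋃-least : ∀ {ps} {q : Subset n} → (∀ {p} → p ∈L ps → p ⊆ q) → ⋃ ps ⊆ q
  ⋃-least {[]}     _ x∈⋃ = ⊥-elim (∉⊥ x∈⋃)
  ⋃-least {p ∷ ps} bound x∈⋃ with x∈p∪q⁻ p (⋃ ps) x∈⋃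
  ... | inj₁ x∈p  = bound (here refl) x∈p
  ... | inj₂ x∈ps = ⋃-least (bound ∘ there) x∈ps

  lookup⊆⋃-toList : ∀ {k} (Ts : Vec (Subset n) k) i → lookup Ts i ⊆ ⋃ (toList Ts)
  lookup⊆⋃-toList Ts i = ⋃-upper (∈-toList⁺ (∈-lookup i Ts))

  ⋃-toList-least : ∀ {k} {Ts : Vec (Subset n) k} {q} → (∀ i → lookup Ts i ⊆ q) → ⋃ (toList Ts) ⊆ q
  ⋃-toList-least {Ts = Ts} {q} bound = ⋃-least {ps = toList Ts} λ p∈Ts →
    let p∈Ts′ = ∈-toList⁻ {xs = Ts} p∈Ts
    in subst (_⊆ q) (sym (lookup-index p∈Ts′)) (bound (index p∈Ts′))

module _ {n : ℕ} (es : List (Subset n)) where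

  isTransversal? : ∀ S → Dec (IsTransversal es S)
  isTransversal? S = (S ⊆? ⋃ es) ×-dec All.all? (λ e → nonempty? (S ∩ e)) es

  isTransversal-mono : ∀ {A B} → A ⊆ B → B ⊆ ⋃ es → IsTransversal es A → IsTransversal es B
  isTransversal-mono {A} A⊆B B⊆⋃ (_ , meets) = B⊆⋃ , All.map meet-B meets
    where
    meet-B : ∀ {e} → Nonempty (A ∩ e) → Nonempty (_ ∩ e)
    meet-B {e} (x , x∈A∩e) = let (x∈A , x∈e) = x∈p∩q⁻ A e x∈A∩e in x , x∈p∩q⁺ (A⊆B x∈A , x∈e)

  -- A strictly smaller transversal S′ misses some v ∈ S, and then S′ ⊆ S - v.
  irredundant⇒isMinTransversal : ∀ {S} → IsTransversal es S →
    (∀ v → v ∈ S → ¬ IsTransversal es (S - v)) → IsMinTransversal es S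
  irredundant⇒isMinTransversal {S} tS irredundant =
    tS , λ { S′ (S′⊆S , v , v∈S , v∉S′) tS′ →
      irredundant v v∈S
        (isTransversal-mono (λ x∈S′ → x∈p∧x≢y⇒x∈p-y (S′⊆S x∈S′) λ { refl → v∉S′ x∈S′ })
                            (proj₁ tS ∘ p─q⊆p S _) tS′) }

  minTransversal-⊆ : ∀ S → IsTransversal es S → ∃ λ M → M ⊆ S × IsMinTransversal es M
  minTransversal-⊆ S = shrink S (<-wellFounded ∣ S ∣)
    where
    shrink : ∀ S → Acc _<_ ∣ S ∣ → IsTransversal es S → ∃ λ M → M ⊆ S × IsMinTransversal es M
    shrink S (acc smaller) tS with any? (λ v → v ∈? S ×-dec isTransversal? (S - v))
    ... | yes (v , v∈S , tS-v) =
      let (M , M⊆S-v , minM) = shrink (S - v) (smaller (x∈p⇒∣p-x∣<∣p∣ v∈S)) tS-v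
      in M , ⊆-trans M⊆S-v (p─q⊆p S _) , minM
    ... | no irredundant =
      S , (λ x∈S → x∈S) , irredundant⇒isMinTransversal tS (λ v v∈S tS-v → irredundant (v , v∈S , tS-v))

  isMinTransversal-⊆⇒≡ : ∀ {S U} → IsMinTransversal es S → U ⊆ S → IsTransversal es U → U ≡ S
  isMinTransversal-⊆⇒≡ {S} {U} (_ , minimal) U⊆S tU = ⊆-antisym U⊆S S⊆U
    where
    S⊆U : S ⊆ U
    S⊆U {x} x∈S with x ∈? U
    ... | yes x∈U = x∈U
    ... | no  x∉U = ⊥-elim (minimal U (U⊆S , x , x∈S , x∉U) tU)

module _ {n k : ℕ} where

  record IsCovering (es : List (Subset n)) (ξs : Vec (List (Subset n)) k) : Set where
    field
      subfamily  : ∀ i {e} → e ∈L lookup ξs i → e ∈L es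
      exhaustive : ∀ {e} → e ∈L es → ∃ λ j → e ∈L lookup ξs j

  module _ {es : List (Subset n)} {ξs : Vec (List (Subset n)) k} (covering : IsCovering es ξs) where
    open IsCovering covering

    inUnionFamily⇒isTransversal : ∀ {S} → InUnionFamily ξs S → IsTransversal es S
    inUnionFamily⇒isTransversal (Ts , minTs , refl) =
      ⋃-toList-least {Ts = Ts} (λ i → ⋃ξᵢ⊆⋃es i ∘ proj₁ (proj₁ (minTs i))) , All.tabulate meets
      where
      ⋃ξᵢ⊆⋃es : ∀ i → ⋃ (lookup ξs i) ⊆ ⋃ es
      ⋃ξᵢ⊆⋃es i = ⋃-least (⋃-upper ∘ subfamily i)

      meets : ∀ {e} → e ∈L es → Nonempty (⋃ (toList Ts) ∩ e)
      meets {e} e∈es =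
        let (j , e∈ξⱼ) = exhaustive e∈es
            (x , x∈Tⱼ∩e) = All.lookup (proj₂ (proj₁ (minTs j))) e∈ξⱼ
            (x∈Tⱼ , x∈e) = x∈p∩q⁻ (lookup Ts j) e x∈Tⱼ∩e
        in x , x∈p∩q⁺ (lookup⊆⋃-toList Ts j x∈Tⱼ , x∈e)

    restrict-isTransversal : ∀ {S} i → IsTransversal es S →
      IsTransversal (lookup ξs i) (S ∩ ⋃ (lookup ξs i))
    restrict-isTransversal {S} i (_ , meets) = proj₂ ∘ x∈p∩q⁻ S _ , All.tabulate meets-restricted
      where
      meets-restricted : ∀ {e} → e ∈L lookup ξs i → Nonempty ((S ∩ ⋃ (lookup ξs i)) ∩ e)
      meets-restricted {e} e∈ξᵢ =
        let (x , x∈S∩e) = All.lookup meets (subfamily i e∈ξᵢ)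
            (x∈S , x∈e) = x∈p∩q⁻ S e x∈S∩e
        in x , x∈p∩q⁺ (x∈p∩q⁺ (x∈S , ⋃-upper e∈ξᵢ x∈e) , x∈e)

    isMinTransversal⇒inUnionFamily : ∀ {S} → IsMinTransversal es S → InUnionFamily ξs S
    isMinTransversal⇒inUnionFamily {S} minS =
      Ts , minTs , sym (isMinTransversal-⊆⇒≡ es minS ⋃Ts⊆S tU)
      where
      pick : ∀ i → ∃ λ M → M ⊆ S ∩ ⋃ (lookup ξs i) × IsMinTransversal (lookup ξs i) M
      pick i = minTransversal-⊆ (lookup ξs i) _ (restrict-isTransversal i (proj₁ minS))

      Ts : Vec (Subset n) k
      Ts = tabulate (proj₁ ∘ pick)

      lookup-Ts : ∀ i → lookup Ts i ≡ proj₁ (pick i)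
      lookup-Ts = lookup∘tabulate (proj₁ ∘ pick)

      minTs : ∀ i → IsMinTransversal (lookup ξs i) (lookup Ts i)
      minTs i = subst (IsMinTransversal (lookup ξs i)) (sym (lookup-Ts i)) (proj₂ (proj₂ (pick i)))

      ⋃Ts⊆S : ⋃ (toList Ts) ⊆ S
      ⋃Ts⊆S = ⋃-toList-least {Ts = Ts} λ i →
        subst (_⊆ S) (sym (lookup-Ts i)) (λ x∈M → proj₁ (x∈p∩q⁻ S _ (proj₁ (proj₂ (pick i)) x∈M)))

      tU : IsTransversal es (⋃ (toList Ts))
      tU = inUnionFamily⇒isTransversal (Ts , minTs , refl)

    isMinTransversal⇔isMinMember : ∀ S → IsMinTransversal es S ⇔ IsMinMember (InUnionFamily ξs) S
    isMinTransversal⇔isMinMember S = mk⇔ to from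
      where
      to : IsMinTransversal es S → IsMinMember (InUnionFamily ξs) S
      to minS = isMinTransversal⇒inUnionFamily minS ,
                λ S′ S′∈F S′⊂S → proj₂ minS S′ S′⊂S (inUnionFamily⇒isTransversal S′∈F)

      -- A smaller transversal would contain a minimal one, which lies in the union family.
      from : IsMinMember (InUnionFamily ξs) S → IsMinTransversal es S
      from (S∈F , minimal) = inUnionFamily⇒isTransversal S∈F , λ S′ S′⊂S tS′ →
        let (M , M⊆S′ , minM) = minTransversal-⊆ es S′ tS′
        in minimal M (isMinTransversal⇒inUnionFamily minM) (⊆-⊂-trans M⊆S′ S′⊂S)

module _ {n : ℕ} where

  partials-subfamily : ∀ {k} (xs : Vec (Fin n) k) es i {e} → e ∈L lookup (partials xs es) i → e ∈L es
  partials-subfamily (x ∷ xs) es Fin.zero    e∈ξ = proj₁ (∈-filter⁻ (x ∈?_) e∈ξ)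
  partials-subfamily (x ∷ xs) es (Fin.suc i) e∈ξ =
    proj₁ (∈-filter⁻ (λ e → ¬? (x ∈? e)) (partials-subfamily xs _ i e∈ξ))

  partials-exhaustive : ∀ {k} (xs : Vec (Fin n) k) es {e} → e ∈L es → ∀ i → lookup xs i ∈ e →
    ∃ λ j → e ∈L lookup (partials xs es) j
  partials-exhaustive (x ∷ xs) es {e} e∈es i xᵢ∈e with x ∈? e
  ... | yes x∈e = Fin.zero , ∈-filter⁺ (x ∈?_) e∈es x∈e
  partials-exhaustive (x ∷ xs) es e∈es Fin.zero    x∈e | no x∉e = ⊥-elim (x∉e x∈e)
  partials-exhaustive (x ∷ xs) es e∈es (Fin.suc i) xᵢ∈e | no x∉e =
    let (j , e∈ξⱼ) = partials-exhaustive xs _ (∈-filter⁺ (λ e → ¬? (x ∈? e)) e∈es x∉e) i xᵢ∈e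
    in Fin.suc j , e∈ξⱼ

  partials-isCovering : ∀ {k} (xs : Vec (Fin n) k) {es T} → IsTransversal es T →
    (∀ {v} → v ∈ T → ∃ λ i → lookup xs i ≡ v) → IsCovering es (partials xs es)
  partials-isCovering xs {es} {T} (_ , meets) enumerates = record
    { subfamily  = partials-subfamily xs es
    ; exhaustive = λ {e} e∈es →
        let (v , v∈T∩e) = All.lookup meets e∈es
            (v∈T , v∈e) = x∈p∩q⁻ T e v∈T∩e
            (i , xᵢ≡v) = enumerates v∈T
        in partials-exhaustive xs es e∈es i (subst (_∈ e) (sym xᵢ≡v) v∈e)
    }

mainTheorem2 :
    ∀ {n} (H : Hypergraph n) (k : ℕ) →
    IsTransversalNumber (edges H) k →
    (T : Subset n) → IsMinTransversal (edges H) T → ∣ T ∣ ≡ k →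
    (xs : Vec (Fin n) k) →
    Injective _≡_ _≡_ (lookup xs) →
    (∀ v → (v ∈ T) ⇔ Σ (Fin k) (λ i → lookup xs i ≡ v)) →
    (∀ (i j : Fin k) → i Fin.≤ j →
       support (edges H) (lookup xs j) ≤ support (edges H) (lookup xs i)) →
    ∀ (S : Subset n) →
      IsMinTransversal (edges H) S
        ⇔ IsMinMember (InUnionFamily (partials xs (edges H))) S
mainTheorem2 H k _ T minT _ xs _ T≡xs _ =
  isMinTransversal⇔isMinMember (partials-isCovering xs (proj₁ minT) (Equivalence.to (T≡xs _)))
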